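{- Let $r$ be a positive integer and let $G=(V\cup U,E)$ be a finite bipartite graph with parts $V,U$ and minimum degree at least $r$. Then $\overleftarrow{m}(G,r)\ge 2\,m(G,r)$.
   Context: A configuration on a graph is an assignment of states in $\{0,1\}$ (inactive/active) to the vertices; its size $|\omega|$ is the number of active vertices. For an updating rule $f$ the induced process is $\omega^{(0)}=\omega$, $\omega^{(t)}=f(\omega^{(t-1)})$. In $r$-bootstrap percolation ($r$-BP), a vertex becomes active if it has at least $r$ active neighbors and otherwise keeps its state (so active vertices stay active forever). In reversible $r$-BP, a vertex is active in the next round iff it has at least $r$ active neighbors in the current round. A dynamo (for a given rule) is an initial configuration such that from some time on all vertices are active in all subsequent rounds. $m(G,r)$ is the minimum size of a dynamo under $r$-BP on $G$, and $\overleftarrow{m}(G,r)$ is the minimum size of a dynamo under reversible $r$-BP on $G$. -}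

module Defs where

open import Data.Nat using (ℕ; zero; suc; _+_; _≤_; _≤ᵇ_)
open import Data.Bool using (Bool; true; false; _∧_; _∨_; if_then_else_)
open import Data.Fin using (Fin; zero; suc)
open import Data.Product using (Σ; _×_; ∃-syntax)
open import Relation.Binary.PropositionalEquality using (_≡_; _≢_)

record Graph (n : ℕ) : Set where
  field
    adj   : Fin n → Fin n → Bool
    sym   : ∀ i j → adj i j ≡ adj j i
    irrefl : ∀ i → adj i i ≡ false
open Graph public

count : ∀ {n} → (Fin n → Bool) → ℕ
count {zero}  f = 0
count {suc n} f = (if f zero then 1 else 0) + count (λ i → f (suc i))

Config : ℕ → Set
Config n = Fin n → Bool

size : ∀ {n} → Config n → ℕ
size ω = count ω

degree : ∀ {n} → Graph n → Fin n → ℕ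
degree G i = count (λ j → adj G i j)

activeNbrs : ∀ {n} → Graph n → Config n → Fin n → ℕ
activeNbrs G ω i = count (λ j → adj G i j ∧ ω j)

Bipartite : ∀ {n} → Graph n → Set
Bipartite {n} G = Σ (Fin n → Bool) λ side →
  (∀ i j → adj G i j ≡ true → side i ≢ side j)

MinDegreeAtLeast : ∀ {n} → Graph n → ℕ → Set
MinDegreeAtLeast G r = ∀ i → r ≤ degree G i

bpStep : ∀ {n} → Graph n → ℕ → Config n → Config n
bpStep G r ω i = ω i ∨ (r ≤ᵇ activeNbrs G ω i)

revStep : ∀ {n} → Graph n → ℕ → Config n → Config n
revStep G r ω i = r ≤ᵇ activeNbrs G ω i

iterate : ∀ {A : Set} → (A → A) → ℕ → A → A
iterate f zero    x = x
iterate f (suc t) x = f (iterate f t x)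

IsDynamo : ∀ {n} → (Config n → Config n) → Config n → Set
IsDynamo {n} f ω = ∃[ T ] (∀ t → T ≤ t → ∀ (i : Fin n) → iterate f t ω i ≡ true)

IsMinDynamoSize : ∀ {n} → (Config n → Config n) → ℕ → Set
IsMinDynamoSize f k =
  (∃[ ω ] (IsDynamo f ω × size ω ≡ k)) × (∀ ω → IsDynamo f ω → k ≤ size ω)

m-is : ∀ {n} → Graph n → ℕ → ℕ → Set
m-is G r k = IsMinDynamoSize (bpStep G r) k

m⃖-is : ∀ {n} → Graph n → ℕ → ℕ → Set
m⃖-is G r k = IsMinDynamoSize (revStep G r) k

module Submission where

open import Defs hiding (sym)
open import Data.Nat using (ℕ; _≤_; _*_; zero; suc; _+_; z≤n; s≤s)
open import Data.Nat.Properties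
  using (≤ᵇ⇒≤; ≤⇒≤ᵇ; ≤-trans; +-mono-≤; +-identityʳ; +-suc; n≤1+n; m≤n⇒m≤1+n; module ≤-Reasoning)
open import Data.Bool using (Bool; true; false; _∧_; _∨_; not; if_then_else_; _≟_)
open import Data.Bool.Properties using (T-≡; ¬-not; not-injective; ∨-zeroʳ)
open import Data.Fin using (Fin)
open import Data.Product using (_,_)
open import Function.Bundles using (Equivalence)
open import Relation.Binary.PropositionalEquality using (_≡_; _≢_; refl; sym; trans; cong)
open import Relation.Nullary using (yes; no)

-- In a bipartite graph a vertex in the part of phase t + 1 (the phase
-- alternates between the two parts) only looks at neighbours in the part of
-- phase t.  Hence bootstrap percolation started from ω restricted to the part
-- of phase 0 dominates the reversible process from ω on the part of phase t
-- at every time t, and as it never deactivates a vertex, it becomes fully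
-- active whenever ω is a reversible dynamo.  So both restrictions of a
-- reversible dynamo are r-BP dynamos, and their sizes add up to |ω|.

count-mono : ∀ {n} (f g : Fin n → Bool) →
             (∀ i → f i ≡ true → g i ≡ true) → count f ≤ count g
count-mono {zero}  f g f⇒g = z≤n
count-mono {suc n} f g f⇒g with f Fin.zero in f₀ | g Fin.zero in g₀
... | true  | true  = s≤s (count-mono _ _ (λ i → f⇒g (Fin.suc i)))
... | true  | false with () ← trans (sym (f⇒g Fin.zero f₀)) g₀
... | false | true  = ≤-trans (count-mono _ _ (λ i → f⇒g (Fin.suc i))) (n≤1+n _)
... | false | false = count-mono _ _ (λ i → f⇒g (Fin.suc i))

count-split : ∀ {n} (f g : Fin n → Bool) →
              count f ≡ count (λ i → f i ∧ g i) + count (λ i → f i ∧ not (g i))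
count-split {zero}  f g = refl
count-split {suc n} f g
  with f Fin.zero | g Fin.zero | count-split (λ i → f (Fin.suc i)) (λ i → g (Fin.suc i))
... | true  | true  | split = cong suc split
... | true  | false | split = trans (cong suc split) (sym (+-suc _ _))
... | false | _     | split = split

inPart : ∀ {n} → (Fin n → Bool) → Bool → Fin n → Bool
inPart side s i = if s then side i else not (side i)

inPart-self : ∀ {n} (side : Fin n → Bool) s i → side i ≡ s → inPart side s i ≡ true
inPart-self side true  i i∈ = i∈
inPart-self side false i i∈ = cong not i∈

restrictTo : ∀ {n} → (Fin n → Bool) → Config n → Config n
restrictTo P ω i = ω i ∧ P i

size-split : ∀ {n} (side : Fin n → Bool) (ω : Config n) →
             size ω ≡ size (restrictTo (inPart side true) ω)
                    + size (restrictTo (inPart side false) ω)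
size-split side ω = count-split ω side

module _ {n} (G : Graph n) (r : ℕ) where

  activeNbrs-mono : ∀ {ω ω′ : Config n} i →
                    (∀ j → adj G i j ≡ true → ω j ≡ true → ω′ j ≡ true) →
                    activeNbrs G ω i ≤ activeNbrs G ω′ i
  activeNbrs-mono {ω} {ω′} i ω⇒ω′ = count-mono _ _ nbr
    where
    nbr : ∀ j → adj G i j ∧ ω j ≡ true → adj G i j ∧ ω′ j ≡ true
    nbr j e with adj G i j in aᵢⱼ
    ... | true = ω⇒ω′ j aᵢⱼ e

  revStep-active⇒threshold : ∀ ω i → revStep G r ω i ≡ true → r ≤ activeNbrs G ω i
  revStep-active⇒threshold ω i e = ≤ᵇ⇒≤ r _ (Equivalence.from T-≡ e)

  threshold⇒bpStep-active : ∀ ω i → r ≤ activeNbrs G ω i → bpStep G r ω i ≡ true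
  threshold⇒bpStep-active ω i r≤ =
    trans (cong (ω i ∨_) (Equivalence.to T-≡ (≤⇒≤ᵇ r≤))) (∨-zeroʳ (ω i))

  bpStep-keeps-active : ∀ ω i → ω i ≡ true → bpStep G r ω i ≡ true
  bpStep-keeps-active ω i e = cong (_∨ revStep G r ω i) e

module _ {n} (G : Graph n) (r : ℕ) (side : Fin n → Bool)
         (bipartite : ∀ i j → adj G i j ≡ true → side i ≢ side j)
         (ω : Config n) (s : Bool) where

  phase : ℕ → Bool
  phase t = iterate not t s

  private
    rev bp : ℕ → Config n
    rev t = iterate (revStep G r) t ω
    bp  t = iterate (bpStep G r) t (restrictTo (inPart side s) ω)

  neighbour-in-previous-phase : ∀ t i j → adj G i j ≡ true →
                                side i ≡ phase (suc t) → side j ≡ phase t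
  neighbour-in-previous-phase t i j aᵢⱼ i∈ =
    not-injective (trans (sym (¬-not (bipartite i j aᵢⱼ))) i∈)

  rev⇒bp-in-phase : ∀ t i → side i ≡ phase t → rev t i ≡ true → bp t i ≡ true
  rev⇒bp-in-phase zero    i i∈ e rewrite e = inPart-self side s i i∈
  rev⇒bp-in-phase (suc t) i i∈ e =
    threshold⇒bpStep-active G r (bp t) i (≤-trans
      (revStep-active⇒threshold G r (rev t) i e)
      (activeNbrs-mono G r i λ j aᵢⱼ →
        rev⇒bp-in-phase t j (neighbour-in-previous-phase t i j aᵢⱼ i∈)))

  restrict-isDynamo : IsDynamo (revStep G r) ω →
                      IsDynamo (bpStep G r) (restrictTo (inPart side s) ω)
  restrict-isDynamo (T , rev-active) = suc T , bp-active
    where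
    bp-active : ∀ t → suc T ≤ t → ∀ i → bp t i ≡ true
    bp-active (suc t) (s≤s T≤t) i with side i ≟ phase t
    ... | yes i∈ = bpStep-keeps-active G r (bp t) i
                     (rev⇒bp-in-phase t i i∈ (rev-active t T≤t i))
    ... | no  i∉ = rev⇒bp-in-phase (suc t) i (¬-not i∉)
                     (rev-active (suc t) (m≤n⇒m≤1+n T≤t) i)

theorem1 : (r : ℕ) → 1 ≤ r → (n : ℕ) → (G : Graph n) → Bipartite G →
    MinDegreeAtLeast G r → (m m⃖ : ℕ) → m-is G r m → m⃖-is G r m⃖ →
    2 * m ≤ m⃖
theorem1 r _ n G (side , bipartite) _ m m⃖ (_ , m-minimal) ((ω , ω-dynamo , |ω|≡m⃖) , _) =
  begin
    2 * m
  ≡⟨ cong (m +_) (+-identityʳ m) ⟩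
    m + m
  ≤⟨ +-mono-≤ (m-minimal _ (half true)) (m-minimal _ (half false)) ⟩
    size (restrictTo (inPart side true) ω) + size (restrictTo (inPart side false) ω)
  ≡⟨ sym (size-split side ω) ⟩
    size ω
  ≡⟨ |ω|≡m⃖ ⟩
    m⃖
  ∎
  where
  open ≤-Reasoning
  half : ∀ s → IsDynamo (bpStep G r) (restrictTo (inPart side s) ω)
  half s = restrict-isDynamo G r side bipartite ω s ω-dynamo
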